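{- Let $p,r,n\geq 1$ be integers, let $G=O\Gamma^{(p,r)}_{n}$, let $i\in\{1,\dots,n\}$, and let $E_i$ be the set of edges of $G$ whose endpoints differ in the $i$th coordinate. Then for any $e=ab$ and $f=xy$ in $E_i$ we have $e\,\Theta\, f$, i.e. $d_G(a,x)+d_G(b,y)\neq d_G(a,y)+d_G(b,x)$.
   Context: For positive integers $p,r,n$, a binary word $a_1a_2\ldots a_n$ is an O-Fibonacci $(p,r)$-word if (1) between any two $1$s there are at least $p-1$ zeros (i.e. if $a_i=1$ then $a_{i+1}=\dots=a_{i+p-1}=0$), and (2) there are at most $r$ "consecutive" $1$s, where two $1$s are called consecutive when exactly $p-1$ zeros separate them; equivalently the word contains at most $r$ consecutive copies of $10^{p-1}$, i.e. it does not contain the factor $(10^{p-1})^{r}1$. The O-Fibonacci $(p,r)$-cube $O\Gamma^{(p,r)}_{n}$ is the subgraph of the hypercube $Q_n$ induced on the set of all O-Fibonacci $(p,r)$-words of length $n$; two words are adjacent iff they differ in exactly one coordinate. $d_G$ is the shortest-path distance in $G$. The Djoković–Winkler relation $\Theta$ on edges: $ab\,\Theta\,xy$ iff $d(a,x)+d(b,y)\neq d(a,y)+d(b,x)$. -}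

module Defs where

open import Data.Nat using (ℕ; zero; suc; _+_; _∸_; _<_; _≤_)
open import Data.Bool using (Bool; true; false)
open import Data.List using (List; []; _∷_; _++_; [_]; replicate; concat)
open import Data.Vec using (Vec; toList; lookup)
open import Data.Fin using (Fin)
open import Data.Product using (_×_; ∃-syntax)
open import Relation.Binary.PropositionalEquality using (_≡_; _≢_)
open import Relation.Nullary using (¬_)

Factor : List Bool → List Bool → Set
Factor f w = ∃[ u ] ∃[ v ] (w ≡ u ++ f ++ v)

block : ℕ → List Bool
block p = true ∷ replicate (p ∸ 1) false

-- O-Fibonacci (p,r)-word:
-- (1) no factor 1 0^k 1 with k < p-1  (at least p-1 zeros between two 1s)
-- (2) no factor (1 0^{p-1})^r 1
IsOFib : ℕ → ℕ → {n : ℕ} → Vec Bool n → Set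
IsOFib p r w =
  (∀ k → k < p ∸ 1 → ¬ Factor (true ∷ replicate k false ++ [ true ]) (toList w))
  × ¬ Factor (concat (replicate r (block p)) ++ [ true ]) (toList w)

DiffExactlyAt : {n : ℕ} → Fin n → Vec Bool n → Vec Bool n → Set
DiffExactlyAt i a b = (lookup a i ≢ lookup b i) × (∀ j → j ≢ i → lookup a j ≡ lookup b j)

AdjQ : {n : ℕ} → Vec Bool n → Vec Bool n → Set
AdjQ {n} a b = ∃[ i ] DiffExactlyAt {n} i a b

-- walks of length k in the O-Fibonacci cube OΓ^{(p,r)}_n (induced subgraph of Q_n)
data Walk (p r : ℕ) {n : ℕ} : Vec Bool n → Vec Bool n → ℕ → Set where
  here : ∀ {a} → IsOFib p r a → Walk p r a a zero
  step : ∀ {a b c k} → IsOFib p r a → AdjQ a b → Walk p r b c k → Walk p r a c (suc k)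

IsDist : (p r : ℕ) {n : ℕ} → Vec Bool n → Vec Bool n → ℕ → Set
IsDist p r a x d = Walk p r a x d × (∀ k → Walk p r a x k → d ≤ k)

InE : (p r : ℕ) {n : ℕ} → Fin n → Vec Bool n → Vec Bool n → Set
InE p r i a b = IsOFib p r a × IsOFib p r b × DiffExactlyAt i a b

module Submission where

-- Key fact: O-Fibonacci words are down-closed in the coordinatewise order
-- (turning 1s into 0s creates neither a factor 1 0^k 1 with k < p-1 nor a
-- run (1 0^{p-1})^r 1).  Hence OΓ^{(p,r)}_n is an isometric subgraph of the
-- hypercube: from a down to the meet a ∧ x and then up to x is a walk of
-- length ham a x, and no walk is shorter since each edge changes the
-- Hamming distance by one.  The theorem thus reduces to its Hamming
-- version, where flipping coordinate i changes each distance by ±1.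

open import Defs
open import Data.Nat using (ℕ; zero; suc; _+_; _≤_; _<_; _∸_; z≤n; s≤s)
open import Data.Nat.Properties
  using (≤-refl; ≤-reflexive; ≤-trans; ≤-antisym; ≤-<-trans; <⇒≤; +-mono-≤; +-assoc; +-comm;
         +-cancelˡ-≡; suc-injective; +-commutativeSemigroup)
open import Data.Bool using (Bool; true; false; _∧_; b≤b; f≤t) renaming (_≤_ to _≤ᵇ_)
open import Data.Bool.Properties using (≤-minimum; ≤-maximum) renaming (≤-refl to ≤ᵇ-refl)
open import Data.List using (List; []; _∷_; _++_; [_]; replicate; concat)
open import Data.List.Properties using (++-assoc)
open import Data.List.Relation.Binary.Pointwise using (Pointwise; []; _∷_)
  renaming (refl to Pointwise-refl)
open import Data.Vec using (Vec; toList; lookup; zipWith; tabulate; _[_]≔_)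
  renaming ([] to []ᵥ; _∷_ to _∷ᵥ_)
open import Data.Vec.Properties using (lookup∘update; lookup∘update′; tabulate∘lookup; tabulate-cong)
open import Data.Fin using (Fin) renaming (zero to fzero; suc to fsuc)
import Data.Fin.Properties as Fin
open import Data.Product using (_×_; _,_; proj₁; ∃-syntax; ∃₂)
open import Data.Sum using (_⊎_; inj₁; inj₂)
open import Relation.Binary.PropositionalEquality
  using (_≡_; _≢_; refl; sym; trans; cong; cong₂; subst; ≢-sym; module ≡-Reasoning)
open import Relation.Nullary using (¬_; contradiction)
open import Algebra.Properties.CommutativeSemigroup +-commutativeSemigroup using (interchange)

_≤ʷ_ : List Bool → List Bool → Set
_≤ʷ_ = Pointwise _≤ᵇ_

Pointwise-++-split : {A B : Set} {R : A → B → Set} (xs : List A) {ys : List A} {zs : List B}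
  → Pointwise R (xs ++ ys) zs
  → ∃₂ λ us vs → zs ≡ us ++ vs × Pointwise R xs us × Pointwise R ys vs
Pointwise-++-split [] {zs = zs} rs = [] , zs , refl , [] , rs
Pointwise-++-split (x ∷ xs) (r ∷ rs) with Pointwise-++-split xs rs
... | us , vs , refl , rxs , rys = _ ∷ us , vs , refl , r ∷ rxs , rys

factor-below : ∀ {f m w} → m ≤ʷ w → Factor f m → ∃[ g ] (f ≤ʷ g × Factor g w)
factor-below {f} m≤w (u , v , refl) with Pointwise-++-split u m≤w
... | u′ , rest , refl , _ , fv≤rest with Pointwise-++-split f fv≤rest
...   | g , v′ , refl , f≤g , _ = g , f≤g , u′ , v′ , refl

factor-trans : ∀ {f g w} → Factor f g → Factor g w → Factor f w
factor-trans {f} (u , v , refl) (u′ , v′ , refl) = u′ ++ u , v ++ v′ , (begin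
  u′ ++ (u ++ f ++ v) ++ v′   ≡⟨ cong (u′ ++_) (++-assoc u (f ++ v) v′) ⟩
  u′ ++ u ++ (f ++ v) ++ v′   ≡⟨ cong (λ t → u′ ++ u ++ t) (++-assoc f v v′) ⟩
  u′ ++ u ++ f ++ v ++ v′     ≡⟨ ++-assoc u′ u (f ++ v ++ v′) ⟨
  (u′ ++ u) ++ f ++ v ++ v′   ∎)
  where open ≡-Reasoning

factor-prepend : ∀ {f w} xs → Factor f w → Factor f (xs ++ w)
factor-prepend {f} xs (u , v , refl) = xs ++ u , v , sym (++-assoc xs u (f ++ v))

gapWord : ℕ → List Bool
gapWord k = true ∷ replicate k false ++ [ true ]

runWord : ℕ → ℕ → List Bool
runWord p r = concat (replicate r (block p)) ++ [ true ]

runWord-suc : ∀ p r → runWord p (suc r) ≡ true ∷ replicate (p ∸ 1) false ++ runWord p r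
runWord-suc p r = cong (true ∷_) (++-assoc (replicate (p ∸ 1) false) (concat (replicate r (block p))) [ true ])

gap-factor : ∀ j v → Factor (gapWord j) (true ∷ replicate j false ++ true ∷ v)
gap-factor j v = [] , v , cong (true ∷_) (sym (++-assoc (replicate j false) [ true ] v))

OneWithin : ℕ → List Bool → Set
OneWithin q g = ∃[ j ] (j < q × ∃[ v ] (g ≡ replicate j false ++ true ∷ v))

oneWithin-gap : ∀ {q g} → OneWithin q g → ∃[ j ] (j < q × Factor (gapWord j) (true ∷ g))
oneWithin-gap (j , j<q , v , refl) = j , j<q , gap-factor j v

zeros-below : ∀ q S {g} → (replicate q false ++ S) ≤ʷ g
  → OneWithin q g ⊎ ∃[ g′ ] (g ≡ replicate q false ++ g′ × S ≤ʷ g′)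
zeros-below zero    S le         = inj₂ (_ , refl , le)
zeros-below (suc q) S (f≤t ∷ _)  = inj₁ (0 , s≤s z≤n , _ , refl)
zeros-below (suc q) S (b≤b ∷ le) with zeros-below q S le
... | inj₁ (j , j<q , v , refl) = inj₁ (suc j , s≤s j<q , v , refl)
... | inj₂ (g′ , refl , S≤g′)   = inj₂ (g′ , refl , S≤g′)

gap-cover : ∀ k {g} → gapWord k ≤ʷ g → ∃[ j ] (j ≤ k × Factor (gapWord j) g)
gap-cover k (b≤b ∷ le) with zeros-below k [ true ] le
... | inj₁ within with oneWithin-gap within
...   | j , j<k , fac = j , <⇒≤ j<k , fac
gap-cover k (b≤b ∷ le) | inj₂ (_ , refl , b≤b ∷ []) = k , ≤-refl , gap-factor k []

run-cover : ∀ p r {g} → runWord p r ≤ʷ g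
  → (∃[ j ] (j < p ∸ 1 × Factor (gapWord j) g)) ⊎ g ≡ runWord p r
run-cover p zero (b≤b ∷ []) = inj₂ refl
run-cover p (suc r) {g} le with subst (_≤ʷ g) (runWord-suc p r) le
... | b≤b ∷ le′ with zeros-below (p ∸ 1) (runWord p r) le′
...   | inj₁ within = inj₁ (oneWithin-gap within)
...   | inj₂ (g′ , refl , le″) with run-cover p r le″
...     | inj₁ (j , j<q , fac) = inj₁ (j , j<q , factor-prepend (true ∷ replicate (p ∸ 1) false) fac)
...     | inj₂ refl = inj₂ (sym (runWord-suc p r))

_⊑_ : ∀ {n} → Vec Bool n → Vec Bool n → Set
m ⊑ w = toList m ≤ʷ toList w

-- O-Fibonacci words are down-closed: a forbidden factor of m ⊑ w would
-- lie below a factor of w, which then contains a forbidden factor itself.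
ofib-down : ∀ p r {n} {m w : Vec Bool n} → m ⊑ w → IsOFib p r w → IsOFib p r m
ofib-down p r {m = m} m⊑w (noGap , noRun) = noGap′ , noRun′
  where
  noGap′ : ∀ k → k < p ∸ 1 → ¬ Factor (gapWord k) (toList m)
  noGap′ k k<q fac with factor-below m⊑w fac
  ... | g , gap≤g , g-in-w with gap-cover k gap≤g
  ...   | j , j≤k , gap-in-g = noGap j (≤-<-trans j≤k k<q) (factor-trans gap-in-g g-in-w)

  noRun′ : ¬ Factor (runWord p r) (toList m)
  noRun′ fac with factor-below m⊑w fac
  ... | g , run≤g , g-in-w with run-cover p r run≤g
  ...   | inj₁ (j , j<q , gap-in-g) = noGap j j<q (factor-trans gap-in-g g-in-w)
  ...   | inj₂ refl = noRun g-in-w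

δ : Bool → Bool → ℕ
δ false false = 0
δ false true  = 1
δ true  false = 1
δ true  true  = 0

ham : ∀ {n} → Vec Bool n → Vec Bool n → ℕ
ham []ᵥ       []ᵥ       = 0
ham (x ∷ᵥ xs) (y ∷ᵥ ys) = δ x y + ham xs ys

δ-self : ∀ x → δ x x ≡ 0
δ-self false = refl
δ-self true  = refl

δ-≢ : ∀ {x y} → x ≢ y → δ x y ≡ 1
δ-≢ {false} {false} x≢y = contradiction refl x≢y
δ-≢ {false} {true}  _   = refl
δ-≢ {true}  {false} _   = refl
δ-≢ {true}  {true}  x≢y = contradiction refl x≢y

δ-triangle : ∀ x y z → δ x z ≤ δ x y + δ y z
δ-triangle false false z     = ≤-refl
δ-triangle true  true  z     = ≤-refl
δ-triangle false true  false = z≤n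
δ-triangle false true  true  = s≤s z≤n
δ-triangle true  false false = s≤s z≤n
δ-triangle true  false true  = z≤n

ham-self : ∀ {n} (a : Vec Bool n) → ham a a ≡ 0
ham-self []ᵥ       = refl
ham-self (x ∷ᵥ a) = cong₂ _+_ (δ-self x) (ham-self a)

ham≡0⇒≡ : ∀ {n} (a b : Vec Bool n) → ham a b ≡ 0 → a ≡ b
ham≡0⇒≡ []ᵥ          []ᵥ          _ = refl
ham≡0⇒≡ (false ∷ᵥ a) (false ∷ᵥ b) e = cong (false ∷ᵥ_) (ham≡0⇒≡ a b e)
ham≡0⇒≡ (true  ∷ᵥ a) (true  ∷ᵥ b) e = cong (true ∷ᵥ_) (ham≡0⇒≡ a b e)

ham-triangle : ∀ {n} (a b c : Vec Bool n) → ham a c ≤ ham a b + ham b c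
ham-triangle []ᵥ       []ᵥ       []ᵥ       = z≤n
ham-triangle (x ∷ᵥ a) (y ∷ᵥ b) (z ∷ᵥ c) = ≤-trans
  (+-mono-≤ (δ-triangle x y z) (ham-triangle a b c))
  (≤-reflexive (interchange (δ x y) (δ y z) (ham a b) (ham b c)))

lookup-ext : ∀ {A : Set} {n} (a b : Vec A n) → (∀ j → lookup a j ≡ lookup b j) → a ≡ b
lookup-ext a b h = begin
  a                   ≡⟨ tabulate∘lookup a ⟨
  tabulate (lookup a) ≡⟨ tabulate-cong h ⟩
  tabulate (lookup b) ≡⟨ tabulate∘lookup b ⟩
  b                   ∎
  where open ≡-Reasoning

diff-sym : ∀ {n i} (a b : Vec Bool n) → DiffExactlyAt i a b → DiffExactlyAt i b a
diff-sym _ _ (aᵢ≢bᵢ , agree) = ≢-sym aᵢ≢bᵢ , λ j j≢i → sym (agree j j≢i)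

diff-head-tails : ∀ {n x y} (a b : Vec Bool n) → DiffExactlyAt fzero (x ∷ᵥ a) (y ∷ᵥ b) → a ≡ b
diff-head-tails a b (_ , agree) = lookup-ext a b (λ j → agree (fsuc j) (λ ()))

diff-tail : ∀ {n x y i} (a b : Vec Bool n) → DiffExactlyAt (fsuc i) (x ∷ᵥ a) (y ∷ᵥ b)
  → x ≡ y × DiffExactlyAt i a b
diff-tail _ _ (ne , agree) = agree fzero (λ ()) , ne , λ j j≢i → agree (fsuc j) (λ e → j≢i (Fin.suc-injective e))

diff⇒ham≡1 : ∀ {n i} (a b : Vec Bool n) → DiffExactlyAt i a b → ham a b ≡ 1
diff⇒ham≡1 {i = fzero} (x ∷ᵥ a) (y ∷ᵥ b) d@(x≢y , _) with diff-head-tails a b d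
... | refl = cong₂ _+_ (δ-≢ x≢y) (ham-self a)
diff⇒ham≡1 {i = fsuc _} (x ∷ᵥ a) (y ∷ᵥ b) d with diff-tail a b d
... | refl , d′ = cong₂ _+_ (δ-self x) (diff⇒ham≡1 a b d′)

update-diff : ∀ {n} (w : Vec Bool n) j {b} → lookup w j ≢ b → DiffExactlyAt j w (w [ j ]≔ b)
update-diff w j {b} wⱼ≢b =
  (λ e → wⱼ≢b (trans e (lookup∘update j w b))) ,
  (λ k k≢j → sym (lookup∘update′ k≢j w b))

clear-⊑ : ∀ {n} (w : Vec Bool n) j → (w [ j ]≔ false) ⊑ w
clear-⊑ (x ∷ᵥ w) fzero    = ≤-minimum x ∷ Pointwise-refl ≤ᵇ-refl
clear-⊑ (x ∷ᵥ w) (fsuc j) = ≤ᵇ-refl ∷ clear-⊑ w j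

find-clearable : ∀ {n} {m w : Vec Bool n} {k} → m ⊑ w → ham m w ≡ suc k
  → ∃[ j ] (lookup w j ≡ true × m ⊑ (w [ j ]≔ false) × ham m (w [ j ]≔ false) ≡ k)
find-clearable {m = []ᵥ} {[]ᵥ} [] ()
find-clearable {m = false ∷ᵥ _} {true ∷ᵥ _} (f≤t ∷ le) e = fzero , refl , b≤b ∷ le , suc-injective e
find-clearable {m = false ∷ᵥ _} {false ∷ᵥ _} (b≤b ∷ le) e with find-clearable le e
... | j , wⱼ , le′ , e′ = fsuc j , wⱼ , b≤b ∷ le′ , e′
find-clearable {m = true ∷ᵥ _} {true ∷ᵥ _} (b≤b ∷ le) e with find-clearable le e
... | j , wⱼ , le′ , e′ = fsuc j , wⱼ , b≤b ∷ le′ , e′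

meet : ∀ {n} → Vec Bool n → Vec Bool n → Vec Bool n
meet = zipWith _∧_

meet⊑ˡ : ∀ {n} (a b : Vec Bool n) → meet a b ⊑ a
meet⊑ˡ []ᵥ          []ᵥ      = []
meet⊑ˡ (false ∷ᵥ a) (y ∷ᵥ b) = b≤b ∷ meet⊑ˡ a b
meet⊑ˡ (true  ∷ᵥ a) (y ∷ᵥ b) = ≤-maximum y ∷ meet⊑ˡ a b

meet⊑ʳ : ∀ {n} (a b : Vec Bool n) → meet a b ⊑ b
meet⊑ʳ []ᵥ          []ᵥ      = []
meet⊑ʳ (false ∷ᵥ a) (y ∷ᵥ b) = ≤-minimum y ∷ meet⊑ʳ a b
meet⊑ʳ (true  ∷ᵥ a) (y ∷ᵥ b) = b≤b ∷ meet⊑ʳ a b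

ham-via-meet : ∀ {n} (a b : Vec Bool n) → ham a b ≡ ham (meet a b) a + ham (meet a b) b
ham-via-meet []ᵥ       []ᵥ       = refl
ham-via-meet (x ∷ᵥ a) (y ∷ᵥ b) = trans
  (cong₂ _+_ (δ-via-∧ x y) (ham-via-meet a b))
  (interchange (δ (x ∧ y) x) (δ (x ∧ y) y) (ham (meet a b) a) (ham (meet a b) b))
  where
  δ-via-∧ : ∀ x y → δ x y ≡ δ (x ∧ y) x + δ (x ∧ y) y
  δ-via-∧ false false = refl
  δ-via-∧ false true  = refl
  δ-via-∧ true  false = refl
  δ-via-∧ true  true  = refl

module Cube (p r : ℕ) where

  _++ʷ_ : ∀ {n} {a b c : Vec Bool n} {k l} → Walk p r a b k → Walk p r b c l → Walk p r a c (k + l)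
  here _       ++ʷ w′ = w′
  step o adj w ++ʷ w′ = step o adj (w ++ʷ w′)

  snoc : ∀ {n} {a b c : Vec Bool n} {k} → Walk p r a b k → AdjQ b c → IsOFib p r c → Walk p r a c (suc k)
  snoc (here o)       adj oc = step o adj (here oc)
  snoc (step o adj w) adj′ oc = step o adj (snoc w adj′ oc)

  reverse : ∀ {n} {a c : Vec Bool n} {k} → Walk p r a c k → Walk p r c a k
  reverse (here o) = here o
  reverse {a = a} (step {b = b} o (i , d) w) = snoc (reverse w) (i , diff-sym a b d) o

  -- Every edge changes the Hamming distance to the target by at most one.
  ham≤length : ∀ {n} {a x : Vec Bool n} {k} → Walk p r a x k → ham a x ≤ k
  ham≤length {a = a} (here _) = subst (_≤ 0) (sym (ham-self a)) z≤n
  ham≤length {a = a} {x} (step {b = b} _ (_ , d) w) = ≤-trans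
    (ham-triangle a b x)
    (subst (λ h → h + ham b x ≤ suc _) (sym (diff⇒ham≡1 a b d)) (s≤s (ham≤length w)))

  descend : ∀ {n} k {m w : Vec Bool n} → m ⊑ w → ham m w ≡ k → IsOFib p r w → Walk p r w m k
  descend zero {m} {w} _ e o with ham≡0⇒≡ m w e
  ... | refl = here o
  descend (suc k) {w = w} m⊑w e o with find-clearable m⊑w e
  ... | j , wⱼ , m⊑w′ , e′ =
    step o (j , update-diff w j (λ wⱼ≡false → contradiction (trans (sym wⱼ) wⱼ≡false) λ ()))
      (descend k m⊑w′ e′ (ofib-down p r (clear-⊑ w j) o))

  geodesic : ∀ {n} {a x : Vec Bool n} → IsOFib p r a → IsOFib p r x → Walk p r a x (ham a x)
  geodesic {a = a} {x} oa ox = subst (Walk p r a x) (sym (ham-via-meet a x))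
    (descend _ (meet⊑ˡ a x) refl oa ++ʷ reverse (descend _ (meet⊑ʳ a x) refl ox))

  dist≡ham : ∀ {n} {a x : Vec Bool n} {d} → IsOFib p r a → IsOFib p r x → IsDist p r a x d → d ≡ ham a x
  dist≡ham oa ox (w , shortest) = ≤-antisym (shortest _ (geodesic oa ox)) (ham≤length w)

-- Flipping coordinate i of x changes ham a x by ±1 according to aᵢ.
ham-swap : ∀ {n i} (x y : Vec Bool n) → DiffExactlyAt i x y → ∀ a
  → ham a x + δ (lookup a i) (lookup y i) ≡ ham a y + δ (lookup a i) (lookup x i)
ham-swap {i = fzero} (x₀ ∷ᵥ x) (y₀ ∷ᵥ y) d (a₀ ∷ᵥ a) with diff-head-tails x y d
... | refl = begin
  (δ a₀ x₀ + ham a x) + δ a₀ y₀ ≡⟨ +-comm (δ a₀ x₀ + ham a x) (δ a₀ y₀) ⟩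
  δ a₀ y₀ + (δ a₀ x₀ + ham a x) ≡⟨ cong (δ a₀ y₀ +_) (+-comm (δ a₀ x₀) (ham a x)) ⟩
  δ a₀ y₀ + (ham a x + δ a₀ x₀) ≡⟨ +-assoc (δ a₀ y₀) (ham a x) (δ a₀ x₀) ⟨
  (δ a₀ y₀ + ham a x) + δ a₀ x₀ ∎
  where open ≡-Reasoning
ham-swap {i = fsuc i} (x₀ ∷ᵥ x) (y₀ ∷ᵥ y) d (a₀ ∷ᵥ a) with diff-tail x y d
... | refl , d′ = begin
  (δ a₀ x₀ + ham a x) + δ aᵢ yᵢ ≡⟨ +-assoc (δ a₀ x₀) (ham a x) (δ aᵢ yᵢ) ⟩
  δ a₀ x₀ + (ham a x + δ aᵢ yᵢ) ≡⟨ cong (δ a₀ x₀ +_) (ham-swap x y d′ a) ⟩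
  δ a₀ x₀ + (ham a y + δ aᵢ xᵢ) ≡⟨ +-assoc (δ a₀ x₀) (ham a y) (δ aᵢ xᵢ) ⟨
  (δ a₀ x₀ + ham a y) + δ aᵢ xᵢ ∎
  where
  open ≡-Reasoning
  aᵢ = lookup a i
  xᵢ = lookup x i
  yᵢ = lookup y i

δ-pairings-differ : ∀ {a b x y} → a ≢ b → x ≢ y → δ a y + δ b x ≢ δ a x + δ b y
δ-pairings-differ {false} {false} a≢b _ = contradiction refl a≢b
δ-pairings-differ {true}  {true}  a≢b _ = contradiction refl a≢b
δ-pairings-differ {x = false} {false} _ x≢y = contradiction refl x≢y
δ-pairings-differ {x = true}  {true}  _ x≢y = contradiction refl x≢y
δ-pairings-differ {false} {true}  {false} {true}  _ _ = λ ()
δ-pairings-differ {false} {true}  {true}  {false} _ _ = λ ()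
δ-pairings-differ {true}  {false} {false} {true}  _ _ = λ ()
δ-pairings-differ {true}  {false} {true}  {false} _ _ = λ ()

cancel-balanced : ∀ L₁ L₂ R₁ R₂ s₁ s₂ t₁ t₂
  → L₁ + s₁ ≡ R₁ + t₁ → L₂ + s₂ ≡ R₂ + t₂ → L₁ + L₂ ≡ R₁ + R₂ → s₁ + s₂ ≡ t₁ + t₂
cancel-balanced L₁ L₂ R₁ R₂ s₁ s₂ t₁ t₂ e₁ e₂ e = +-cancelˡ-≡ (L₁ + L₂) _ _ (begin
  (L₁ + L₂) + (s₁ + s₂) ≡⟨ interchange L₁ L₂ s₁ s₂ ⟩
  (L₁ + s₁) + (L₂ + s₂) ≡⟨ cong₂ _+_ e₁ e₂ ⟩
  (R₁ + t₁) + (R₂ + t₂) ≡⟨ interchange R₁ t₁ R₂ t₂ ⟩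
  (R₁ + R₂) + (t₁ + t₂) ≡⟨ cong (_+ (t₁ + t₂)) e ⟨
  (L₁ + L₂) + (t₁ + t₂) ∎)
  where open ≡-Reasoning

hamming-Θ : ∀ {n i} (a b x y : Vec Bool n) → DiffExactlyAt i a b → DiffExactlyAt i x y
  → ham a x + ham b y ≢ ham a y + ham b x
hamming-Θ a b x y a~b x~y e =
  δ-pairings-differ (proj₁ a~b) (proj₁ x~y)
    (cancel-balanced (ham a x) (ham b y) (ham a y) (ham b x) _ _ _ _
      (ham-swap x y x~y a) (ham-swap y x (diff-sym x y x~y) b) e)

open Cube using (dist≡ham)

corollary3p3 : (p r n : ℕ) → 1 ≤ p → 1 ≤ r → 1 ≤ n → (i : Fin n)
    → (a b x y : Vec Bool n) → InE p r i a b → InE p r i x y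
    → (dax dby day dbx : ℕ)
    → IsDist p r a x dax → IsDist p r b y dby
    → IsDist p r a y day → IsDist p r b x dbx
    → dax + dby ≢ day + dbx
corollary3p3 p r n _ _ _ i a b x y (oa , ob , a~b) (ox , oy , x~y) dax dby day dbx Dax Dby Day Dbx
  rewrite dist≡ham p r oa ox Dax | dist≡ham p r ob oy Dby
        | dist≡ham p r oa oy Day | dist≡ham p r ob ox Dbx
  = hamming-Θ a b x y a~b x~y
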